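{- Let $G=(V,E)$ be a multigraph and $\mathcal{P}$ a partition of $V$. Let $C$ be a minimum cut of $G$. Then either $C$ is a terminal cut with respect to the terminal set $T_{G,\mathcal{P}}$, or there is a cluster $P\in\mathcal{P}$ such that every edge of the cut-set of $C$ lies in $G[P]$ and all vertices of $T_{G,\mathcal{P}}$ lie on the same side of $C$.
   Context: A multigraph has edges $(u,v,\alpha)$ with positive integer multiplicity $\alpha$. A cut is a bipartition of $V$ into two non-empty sets; its cut-set is the set of crossing edges and its size the sum of their multiplicities; a minimum cut has smallest size. For $X\subseteq V$, $G[X]$ is the induced subgraph and $\partial_G(X)$ the set of edges with exactly one endpoint in $X$. For a partition $\mathcal{P}$ of $V$, $T_{G,\mathcal{P}}$ is the set of endpoints of edges in $\bigcup_{P\in\mathcal{P}}\partial_G(P)$ (the boundary vertices). A cut is a terminal cut with respect to a terminal set $T$ if it partitions $T$ into two non-empty sets. -}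

module Defs where

open import Data.Nat using (ℕ; _+_; _≤_; _<_)
open import Data.Fin using (Fin)
open import Data.Bool using (Bool; true; false; if_then_else_)
open import Data.List using (List; []; _∷_)
open import Data.List.Membership.Propositional using (_∈_)
open import Data.List.Relation.Unary.All using (All)
open import Data.Product using (Σ; ∃; ∃-syntax; _×_; _,_)
open import Data.Sum using (_⊎_)
open import Relation.Binary.PropositionalEquality using (_≡_; _≢_)
open import Relation.Nullary using (¬_; yes; no)
open import Data.Bool.Properties using () renaming (_≟_ to _≟ᵇ_)

record Edge (n : ℕ) : Set where
  constructor edge
  field
    src  : Fin n
    dst  : Fin n
    mult : ℕ
open Edge public

record Multigraph (n : ℕ) : Set where
  field
    edges    : List (Edge n)
    mult-pos : All (λ e → 0 < mult e) edges
open Multigraph public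

-- A partition of V = Fin n into k clusters, given by a cluster-labelling
-- that is surjective (every cluster is non-empty).  Cluster i is the
-- set { v | cl v ≡ i }.
record Partition (n : ℕ) : Set where
  field
    k      : ℕ
    cl     : Fin n → Fin k
    onto   : ∀ (i : Fin k) → ∃[ v ] cl v ≡ i
open Partition public

record Cut (n : ℕ) : Set where
  field
    side     : Fin n → Bool
    nonempty : (∃[ v ] side v ≡ true) × (∃[ v ] side v ≡ false)
open Cut public

Crosses : {n : ℕ} → Cut n → Edge n → Set
Crosses C e = side C (src e) ≢ side C (dst e)

cutSize : {n : ℕ} → Cut n → List (Edge n) → ℕ
cutSize C [] = 0
cutSize C (e ∷ es) with side C (src e) ≟ᵇ side C (dst e)
... | yes _ = cutSize C es
... | no  _ = mult e + cutSize C es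

IsMinCut : {n : ℕ} → Multigraph n → Cut n → Set
IsMinCut G C = ∀ (C′ : Cut _) → cutSize C (edges G) ≤ cutSize C′ (edges G)

-- An edge lies in ⋃_{P ∈ 𝒫} ∂_G(P) iff its endpoints are in different clusters.
InterCluster : {n : ℕ} → Partition n → Edge n → Set
InterCluster 𝒫 e = cl 𝒫 (src e) ≢ cl 𝒫 (dst e)

InT : {n : ℕ} → Multigraph n → Partition n → Fin n → Set
InT G 𝒫 v = ∃[ e ] (e ∈ edges G × InterCluster 𝒫 e × (src e ≡ v ⊎ dst e ≡ v))

IsTerminalCut : {n : ℕ} → (Fin n → Set) → Cut n → Set
IsTerminalCut T C = (∃[ t ] (T t × side C t ≡ true)) × (∃[ t ] (T t × side C t ≡ false))

InCluster : {n : ℕ} → (𝒫 : Partition n) → Fin (k 𝒫) → Edge n → Set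
InCluster 𝒫 i e = (cl 𝒫 (src e) ≡ i) × (cl 𝒫 (dst e) ≡ i)

{-# OPTIONS --safe #-}
-- If C is not a terminal cut, one side S of C contains no boundary vertex, so
-- no inter-cluster edge has an endpoint in S.  Hence every crossing edge lies
-- inside a cluster and all boundary vertices lie on the other side.  Fix u ∈ S
-- in cluster P.  Were some crossing edge inside another cluster, the cut
-- (S ∩ P, rest) would cross only edges already crossed by C, but not that
-- one, and so, multiplicities being positive, would be smaller than C.
module Submission where

open import Defs
open import Data.Nat using (ℕ; _≤_; _<_; z≤n)
open import Data.Nat.Properties using (≤-trans; ≤-<-trans; <-≤-trans; m≤n+m; m<n+m; +-monoʳ-≤; +-monoʳ-<; <⇒≱)
open import Data.Fin using (Fin)
open import Data.Fin.Properties using (_≟_; any?)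
open import Data.Bool using (Bool; true; false; not; _∧_)
open import Data.Bool.Properties using (¬-not; not-involutive; ∧-zeroʳ) renaming (_≟_ to _≟ᵇ_)
open import Data.List using (List; []; _∷_)
open import Data.List.Membership.Propositional using (_∈_; find; lose)
open import Data.List.Relation.Unary.All using (All; _∷_)
open import Data.List.Relation.Unary.Any using (here; there) renaming (any? to anyEdge?)
open import Data.Product using (∃-syntax; _×_; _,_; proj₁; proj₂)
open import Data.Sum using (_⊎_; inj₁; inj₂; [_,_])
open import Function using (_∘_)
open import Relation.Nullary using (¬_; Dec; yes; no; does; contradiction)
open import Relation.Nullary.Decidable using (dec-true; dec-false; decidable-stable; map′; ¬?; _×-dec_; _⊎-dec_)
open import Relation.Unary using (Decidable)
open import Relation.Binary.PropositionalEquality using (_≡_; _≢_; refl; sym; trans; cong; cong₂)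

private variable n : ℕ

≢⇒either≡ : ∀ {x y} b → x ≢ y → x ≡ b ⊎ y ≡ b
≢⇒either≡ {y = y} b x≢y with y ≟ᵇ b
... | yes y≡b = inj₂ y≡b
... | no y≢b = inj₁ (trans (¬-not x≢y) (trans (cong not (¬-not y≢b)) (not-involutive b)))

∧-≢ : ∀ {x₁ x₂ y₁ y₂} → x₁ ∧ y₁ ≢ x₂ ∧ y₂ → x₁ ≢ x₂ ⊎ y₁ ≢ y₂
∧-≢ {x₁} {x₂} {y₁} {y₂} ne with x₁ ≟ᵇ x₂ | y₁ ≟ᵇ y₂
... | no x₁≢x₂ | _         = inj₁ x₁≢x₂
... | yes _    | no y₁≢y₂  = inj₂ y₁≢y₂
... | yes refl | yes refl  = contradiction refl ne

side-inhabited : (C : Cut n) (b : Bool) → ∃[ u ] side C u ≡ b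
side-inhabited C true  = proj₁ (nonempty C)
side-inhabited C false = proj₂ (nonempty C)

_⊆[_]_ : Cut n → List (Edge n) → Cut n → Set
C′ ⊆[ es ] C = ∀ {e} → e ∈ es → Crosses C′ e → Crosses C e

cutSize-mono : (C′ C : Cut n) (es : List (Edge n)) → C′ ⊆[ es ] C →
               cutSize C′ es ≤ cutSize C es
cutSize-mono C′ C []       _   = z≤n
cutSize-mono C′ C (e ∷ es) sub
  with side C′ (src e) ≟ᵇ side C′ (dst e) | side C (src e) ≟ᵇ side C (dst e)
     | cutSize-mono C′ C es (sub ∘ there)
... | yes _   | yes _   | ih = ih
... | yes _   | no _    | ih = ≤-trans ih (m≤n+m _ (mult e))
... | no e∦C′ | yes e∥C | _  = contradiction e∥C (sub (here refl) e∦C′)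
... | no _    | no _    | ih = +-monoʳ-≤ (mult e) ih

cutSize-strictMono : (C′ C : Cut n) (es : List (Edge n)) → All (λ e → 0 < mult e) es →
                     C′ ⊆[ es ] C → ∀ {e} → e ∈ es → Crosses C e → ¬ Crosses C′ e →
                     cutSize C′ es < cutSize C es
cutSize-strictMono C′ C (e ∷ es) (e>0 ∷ _) sub (here refl) e∦C e∥C′
  with side C′ (src e) ≟ᵇ side C′ (dst e) | side C (src e) ≟ᵇ side C (dst e)
... | yes _   | no _    = ≤-<-trans (cutSize-mono C′ C es (sub ∘ there)) (m<n+m _ e>0)
... | yes _   | yes e∥C = contradiction e∥C e∦C
... | no e∦C′ | _       = contradiction e∦C′ e∥C′
cutSize-strictMono C′ C (x ∷ es) (_ ∷ pos) sub (there e∈es) e∦C e∥C′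
  with side C′ (src x) ≟ᵇ side C′ (dst x) | side C (src x) ≟ᵇ side C (dst x)
     | cutSize-strictMono C′ C es pos (sub ∘ there) e∈es e∦C e∥C′
... | yes _   | yes _   | ih = ih
... | yes _   | no _    | ih = <-≤-trans ih (m≤n+m _ (mult x))
... | no x∦C′ | yes x∥C | _  = contradiction x∥C (sub (here refl) x∦C′)
... | no _    | no _    | ih = +-monoʳ-< (mult x) ih

InT? : (G : Multigraph n) (𝒫 : Partition n) → Decidable (InT G 𝒫)
InT? G 𝒫 v = map′ find (λ (e , e∈ , pe) → lose e∈ pe) (anyEdge? isInterEndpoint? (edges G))
  where
  isInterEndpoint? : (e : Edge _) → Dec (InterCluster 𝒫 e × (src e ≡ v ⊎ dst e ≡ v))
  isInterEndpoint? e = ¬? (cl 𝒫 (src e) ≟ cl 𝒫 (dst e)) ×-dec (src e ≟ v ⊎-dec dst e ≟ v)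

terminalCut⊎freeSide : {T : Fin n → Set} → Decidable T → (C : Cut n) →
                       IsTerminalCut T C ⊎ ∃[ b ] (∀ t → T t → side C t ≢ b)
terminalCut⊎freeSide T? C
  with any? (λ t → T? t ×-dec side C t ≟ᵇ true) | any? (λ t → T? t ×-dec side C t ≟ᵇ false)
... | yes t₁  | yes t₂  = inj₁ (t₁ , t₂)
... | no none | _       = inj₂ (true  , λ t Tt t∈b → none (t , Tt , t∈b))
... | yes _   | no none = inj₂ (false , λ t Tt t∈b → none (t , Tt , t∈b))

module TerminalFreeSide (G : Multigraph n) (𝒫 : Partition n) (C : Cut n) {b : Bool}
                        (free : ∀ t → InT G 𝒫 t → side C t ≢ b) where

  interCluster-offSide : ∀ {e} → e ∈ edges G → InterCluster 𝒫 e →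
                         side C (src e) ≢ b × side C (dst e) ≢ b
  interCluster-offSide {e} e∈ inter =
    free (src e) (e , e∈ , inter , inj₁ refl) , free (dst e) (e , e∈ , inter , inj₂ refl)

  crossing⇒intraCluster : ∀ {e} → e ∈ edges G → Crosses C e → cl 𝒫 (src e) ≡ cl 𝒫 (dst e)
  crossing⇒intraCluster e∈ e∦C = decidable-stable (_ ≟ _) λ inter →
    let src∉b , dst∉b = interCluster-offSide e∈ inter in [ src∉b , dst∉b ] (≢⇒either≡ b e∦C)

  terminals-sameSide : ∀ t t′ → InT G 𝒫 t → InT G 𝒫 t′ → side C t ≡ side C t′
  terminals-sameSide t t′ t∈T t′∈T = trans (¬-not (free t t∈T)) (sym (¬-not (free t′ t′∈T)))

  onSideIn : Fin (k 𝒫) → Fin n → Bool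
  onSideIn P v = does (side C v ≟ᵇ b) ∧ does (cl 𝒫 v ≟ P)

  onSideIn-true : ∀ {P v} → side C v ≡ b → cl 𝒫 v ≡ P → onSideIn P v ≡ true
  onSideIn-true v∈b v∈P = cong₂ _∧_ (dec-true (_ ≟ᵇ _) v∈b) (dec-true (_ ≟ _) v∈P)

  offSide⇒¬onSideIn : ∀ {P v} → side C v ≢ b → onSideIn P v ≡ false
  offSide⇒¬onSideIn v∉b = cong (_∧ _) (dec-false (_ ≟ᵇ _) v∉b)

  outside⇒¬onSideIn : ∀ {P v} → cl 𝒫 v ≢ P → onSideIn P v ≡ false
  outside⇒¬onSideIn v∉P = trans (cong (_ ∧_) (dec-false (_ ≟ _) v∉P)) (∧-zeroʳ _)

  onSideIn-crossing⇒crossing : ∀ P {e} → e ∈ edges G → onSideIn P (src e) ≢ onSideIn P (dst e) →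
                               Crosses C e
  onSideIn-crossing⇒crossing P {e} e∈ e∦ with ∧-≢ e∦
  ... | inj₁ b-differs = b-differs ∘ cong (λ s → does (s ≟ᵇ b))
  ... | inj₂ P-differs =
    let src∉b , dst∉b = interCluster-offSide e∈ (P-differs ∘ cong (λ c → does (c ≟ P)))
    in contradiction (trans (offSide⇒¬onSideIn src∉b) (sym (offSide⇒¬onSideIn dst∉b))) e∦

  cutOff : (u v : Fin n) → side C u ≡ b → cl 𝒫 v ≢ cl 𝒫 u → Cut n
  cutOff u v u∈b v∉P = record
    { side     = onSideIn (cl 𝒫 u)
    ; nonempty = (u , onSideIn-true u∈b refl) , (v , outside⇒¬onSideIn v∉P)
    }

  cutOff-smaller : ∀ {u e} (u∈b : side C u ≡ b) → e ∈ edges G → Crosses C e →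
                   (src∉P : cl 𝒫 (src e) ≢ cl 𝒫 u) →
                   cutSize (cutOff u (src e) u∈b src∉P) (edges G) < cutSize C (edges G)
  cutOff-smaller {u} {e} u∈b e∈ e∦C src∉P =
    cutSize-strictMono (cutOff u (src e) u∈b src∉P) C (edges G) (mult-pos G)
      (onSideIn-crossing⇒crossing (cl 𝒫 u)) e∈ e∦C λ e∦C′ → e∦C′ (trans
        (outside⇒¬onSideIn src∉P)
        (sym (outside⇒¬onSideIn (src∉P ∘ trans (crossing⇒intraCluster e∈ e∦C)))))

  minCut-crossing⇒inCluster : IsMinCut G C → ∀ {u} → side C u ≡ b →
                              ∀ e → e ∈ edges G → Crosses C e → InCluster 𝒫 (cl 𝒫 u) e
  minCut-crossing⇒inCluster min {u} u∈b e e∈ e∦C = src∈P , trans (sym intra) src∈P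
    where
    intra : cl 𝒫 (src e) ≡ cl 𝒫 (dst e)
    intra = crossing⇒intraCluster e∈ e∦C
    src∈P : cl 𝒫 (src e) ≡ cl 𝒫 u
    src∈P = decidable-stable (_ ≟ _) λ src∉P →
      <⇒≱ (cutOff-smaller u∈b e∈ e∦C src∉P) (min (cutOff u (src e) u∈b src∉P))

lemma4p3 : {n : ℕ} (G : Multigraph n) (𝒫 : Partition n) (C : Cut n) →
    IsMinCut G C →
    IsTerminalCut (InT G 𝒫) C
    ⊎ (∃[ P ] ((∀ e → e ∈ edges G → Crosses C e → InCluster 𝒫 P e)
               × (∀ t t′ → InT G 𝒫 t → InT G 𝒫 t′ → side C t ≡ side C t′)))
lemma4p3 G 𝒫 C min with terminalCut⊎freeSide (InT? G 𝒫) C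
... | inj₁ terminal   = inj₁ terminal
... | inj₂ (b , free) =
  let open TerminalFreeSide G 𝒫 C free
      u , u∈b = side-inhabited C b
  in inj₂ (cl 𝒫 u , minCut-crossing⇒inCluster min u∈b , terminals-sameSide)
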